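{- Let $p$ be a prime, $s\ge1$, $n,m\ge1$ and $0\le i\le m-1$ integers, and $j\ge0$ an integer. Then \[ E_i(n\times m,p^s,p^j)=E(n\times m,p^{s-1},p^{j-m})+\sum_{k=i}^{\min(j,m-1)}\tilde E_k(n\times m,p^s,p^j) \] (the sum being empty if $j<i$). Moreover $E_i(n\times m,p^s,p^j)=0$ for $j<i$.
   Context: For $t\ge0$, $\mathbb{Z}_{p^t}$ is the ring of integers modulo $p^t$ ($\mathbb{Z}_1$ is the zero ring, whose unique matrix has exactly one solution). $E(n\times m,p^t,p^j)$ is the number of $n\times m$ matrices over $\mathbb{Z}_{p^t}$ such that $Ax\equiv0\pmod{p^t}$ has exactly $p^j$ solutions in $\mathbb{Z}_{p^t}^m$ ($0$ if $j<0$). $E_i(n\times m,p^s,p^j)$ is the number of $n\times m$ matrices over $\mathbb{Z}_{p^s}$ with exactly $p^j$ solutions whose first $i$ columns have all entries divisible by $p$. A matrix over $\mathbb{Z}_{p^s}$ is relatively prime if at least one entry is not divisible by $p$. $\tilde E_k(n\times m,p^s,p^j)$ is the number of relatively prime $n\times m$ matrices over $\mathbb{Z}_{p^s}$ with exactly $p^j$ solutions in which the first column containing an entry not divisible by $p$ is column $k+1$. -}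

module Defs where

open import Data.Nat using (ℕ; zero; suc; _+_; _*_; _∸_; _^_; _<ᵇ_)
open import Data.Nat.Divisibility using (_∣?_)
open import Data.Integer using (ℤ; +_; -[1+_])
open import Data.Fin using (Fin; toℕ)
open import Data.Bool using (Bool; true; false; _∧_; not; if_then_else_)
open import Data.List using (List; []; _∷_; map; concatMap; upTo; length)
open import Data.Nat.ListAction using (sum)
import Data.List as L
open import Data.Vec using (Vec; []; _∷_; toList; lookup; allFin; zipWith)
import Data.Vec as V
open import Relation.Nullary.Decidable using (⌊_⌋)

-- Residues modulo q are represented by Fin q (for q = p^t); Fin 1 is the zero ring.
-- An n × m matrix is a vector of n rows, each a vector of m entries.
Matrix : ℕ → ℕ → ℕ → Set
Matrix n m q = Vec (Vec (Fin q) m) n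

allVecs : (q k : ℕ) → List (Vec (Fin q) k)
allVecs q zero = [] ∷ []
allVecs q (suc k) =
  concatMap (λ a → map (a ∷_) (allVecs q k)) (toList (allFin q))

allMatrices : (n m q : ℕ) → List (Matrix n m q)
allMatrices zero m q = [] ∷ []
allMatrices (suc n) m q =
  concatMap (λ r → map (r ∷_) (allMatrices n m q)) (allVecs q m)

countᵇ : {A : Set} → (A → Bool) → List A → ℕ
countᵇ P xs = length (L.filterᵇ P xs)

allᵇ : {A : Set} → (A → Bool) → List A → Bool
allᵇ P [] = true
allᵇ P (x ∷ xs) = P x ∧ allᵇ P xs

anyᵇ : {A : Set} → (A → Bool) → List A → Bool
anyᵇ P xs = not (allᵇ (λ x → not (P x)) xs)

dot : {q m : ℕ} → Vec (Fin q) m → Vec (Fin q) m → ℕ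
dot r x = V.sum (zipWith (λ a b → toℕ a * toℕ b) r x)

isSolution : {n m q : ℕ} → Matrix n m q → Vec (Fin q) m → Bool
isSolution {q = q} A x = allᵇ (λ r → ⌊ q ∣? dot r x ⌋) (toList A)

numSolutions : {n m q : ℕ} → Matrix n m q → ℕ
numSolutions {m = m} {q = q} A = countᵇ (isSolution A) (allVecs q m)

_≡ᵇ_ : ℕ → ℕ → Bool
zero ≡ᵇ zero = true
zero ≡ᵇ suc b = false
suc a ≡ᵇ zero = false
suc a ≡ᵇ suc b = a ≡ᵇ b

E : (n m p t : ℕ) → ℤ → ℕ
E n m p t (+ j) = countᵇ (λ A → numSolutions A ≡ᵇ (p ^ j)) (allMatrices n m (p ^ t))
E n m p t -[1+ _ ] = 0

divByᵇ : {q : ℕ} → ℕ → Fin q → Bool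
divByᵇ p a = ⌊ p ∣? toℕ a ⌋

colDiv : {n m q : ℕ} → ℕ → Matrix n m q → Fin m → Bool
colDiv p A c = allᵇ (λ r → divByᵇ p (lookup r c)) (toList A)

firstColsDiv : {n m q : ℕ} → ℕ → ℕ → Matrix n m q → Bool
firstColsDiv {m = m} p i A =
  allᵇ (λ c → if toℕ c <ᵇ i then colDiv p A c else true) (toList (allFin m))

relPrime : {n m q : ℕ} → ℕ → Matrix n m q → Bool
relPrime p A = anyᵇ (λ r → anyᵇ (λ a → not (divByᵇ p a)) (toList r)) (toList A)

-- the column with 0-based index k (i.e. column k+1) contains a non-divisible entry
colNonDiv : {n m q : ℕ} → ℕ → ℕ → Matrix n m q → Bool
colNonDiv {m = m} p k A =
  anyᵇ (λ c → if toℕ c ≡ᵇ k then not (colDiv p A c) else false) (toList (allFin m))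

Ei : (n m p s i j : ℕ) → ℕ
Ei n m p s i j =
  countᵇ (λ A → (numSolutions A ≡ᵇ (p ^ j)) ∧ firstColsDiv p i A)
         (allMatrices n m (p ^ s))

-- Ẽ_k(n×m, p^s, p^j): relatively prime, first column with a non-divisible entry is column k+1
Et : (n m p s k j : ℕ) → ℕ
Et n m p s k j =
  countᵇ (λ A → (numSolutions A ≡ᵇ (p ^ j)) ∧ relPrime p A ∧ firstColsDiv p k A ∧ colNonDiv p k A)
         (allMatrices n m (p ^ s))

sumRange : ℕ → ℕ → (ℕ → ℕ) → ℕ
sumRange a b f = sum (map (λ d → f (a + d)) (upTo (suc b ∸ a)))

-- Split the matrices counted by Eᵢ by whether every entry is divisible by p.  If so, A = p B for a
-- matrix B over Z_(p^(s-1)); since p r · x ≡ 0 (mod p^s) iff r · x ≡ 0 (mod p^(s-1)), the solutions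
-- of A are the p^m lifts of those of B, so these A are counted by E(n×m, p^(s-1), p^(j-m)).
-- Otherwise let c be the first column with an entry prime to p: then A is counted by Ẽ_c, and the
-- first i columns of A are divisible by p exactly when i ≤ c.  The vectors whose first c entries are
-- multiples of p^(s-1) and whose other entries vanish are p^c solutions of A, so c ≤ j; this cuts
-- the sum off at min(j, m-1) and also shows that Eᵢ vanishes for j < i.

module Submission where

open import Defs
open import Data.Bool using (Bool; true; false; _∧_; not; if_then_else_; T)
open import Data.Bool.Properties using (∧-conicalˡ; ∧-conicalʳ; ∧-zeroʳ; ∧-identityʳ; not-involutive; T-≡)
open import Data.Empty using (⊥-elim)
open import Data.Fin using (Fin; toℕ; combine; remQuot; cast; _↑ˡ_; _↑ʳ_) renaming (zero to fzero; suc to fsuc)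
open import Data.Fin.Properties using (toℕ-combine; toℕ-cast; remQuot-combine; combine-remQuot; toℕ<n)
open import Data.List using (List; []; _∷_; map; concatMap; upTo; applyUpTo; _++_)
open import Data.List.Properties using (map-++; map-∘; map-cong)
open import Data.Nat
  using (ℕ; zero; suc; _+_; _*_; _∸_; _^_; _≤_; _<_; _⊓_; z≤n; s≤s; z<s; _<ᵇ_; _≟_; _<?_; _≤?_;
         NonZero; >-nonZero; >-nonZero⁻¹; nonTrivial⇒n>1)
open import Data.Nat.Primality using (Prime; prime⇒nonTrivial)
open import Data.Nat.ListAction using () renaming (sum to sumˡ)
open import Data.Nat.ListAction.Properties using (sum-++)
open import Data.Nat.Properties hiding (≡⇒≡ᵇ; ≡ᵇ⇒≡)
open import Data.Nat.DivMod using (_%_; [m+kn]%n≡m%n; %-distribˡ-+; %-distribˡ-*)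
open import Data.Nat.Divisibility
  using (_∣_; _∣?_; _∣0; ∣⇒≤; m∣m*n; ∣m∣n⇒∣m+n; ∣m+n∣m⇒∣n; *-pres-∣; *-monoʳ-∣; *-cancelˡ-∣; m%n≡0⇒n∣m; n∣m⇒m%n≡0)
import Data.Integer as ℤ
open import Data.Integer.Properties using (m-n≡m⊖n; ⊖-≥; ⊖-<)
open import Data.Product using (_×_; _,_; proj₁; proj₂; Σ-syntax)
open import Data.Vec using (Vec; []; _∷_; toList; lookup; allFin; tabulate)
import Data.Vec as V
open import Data.Vec.Properties using (lookup-allFin; toList-map)
open import Function using (_∘_; _⇔_; mk⇔; Equivalence)
open import Relation.Binary.PropositionalEquality
open import Relation.Binary.Definitions using (tri<; tri≈; tri>)
open import Relation.Nullary using (Dec; yes; no; ¬_; does; contradiction)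
open import Relation.Nullary.Decidable using (⌊_⌋; isYes≗does; dec-true; dec-false; does-⇔)

open import Algebra.Properties.CommutativeSemigroup +-commutativeSemigroup using (interchange)
open import Algebra.Properties.Semiring.Sum +-*-semiring using (sum; sum-syntax; sum-cong-≗; *-distribˡ-sum)

-- _≡ᵇ_ is the one from Defs, not Data.Nat's builtin (whose lemmas are hidden above).
≡ᵇ-does : ∀ a b → (a ≡ᵇ b) ≡ does (a ≟ b)
≡ᵇ-does zero    zero    = refl
≡ᵇ-does zero    (suc b) = refl
≡ᵇ-does (suc a) zero    = refl
≡ᵇ-does (suc a) (suc b) = ≡ᵇ-does a b

≡⇒≡ᵇ : ∀ {a b} → a ≡ b → (a ≡ᵇ b) ≡ true
≡⇒≡ᵇ {a} {b} a≡b = trans (≡ᵇ-does a b) (dec-true (a ≟ b) a≡b)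

≢⇒≡ᵇ : ∀ {a b} → a ≢ b → (a ≡ᵇ b) ≡ false
≢⇒≡ᵇ {a} {b} a≢b = trans (≡ᵇ-does a b) (dec-false (a ≟ b) a≢b)

≡ᵇ⇒≡ : ∀ {a b} → (a ≡ᵇ b) ≡ true → a ≡ b
≡ᵇ⇒≡ {a} {b} h with a ≟ b
... | yes a≡b = a≡b
... | no  a≢b = contradiction (trans (sym (≢⇒≡ᵇ a≢b)) h) λ ()

≡ᵇ-⇔ : ∀ {a b c d} → (a ≡ b ⇔ c ≡ d) → (a ≡ᵇ b) ≡ (c ≡ᵇ d)
≡ᵇ-⇔ {a} {b} {c} {d} iff =
  trans (≡ᵇ-does a b) (trans (does-⇔ iff (a ≟ b) (c ≟ d)) (sym (≡ᵇ-does c d)))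

≡ᵇ-+ : ∀ a x y → ((a + x) ≡ᵇ (a + y)) ≡ (x ≡ᵇ y)
≡ᵇ-+ zero    x y = refl
≡ᵇ-+ (suc a) x y = ≡ᵇ-+ a x y

⌊⌋-true : {P : Set} (d : Dec P) → P → ⌊ d ⌋ ≡ true
⌊⌋-true d p = trans (isYes≗does d) (dec-true d p)

⌊⌋-false : {P : Set} (d : Dec P) → ¬ P → ⌊ d ⌋ ≡ false
⌊⌋-false d ¬p = trans (isYes≗does d) (dec-false d ¬p)

⌊⌋⇒ : {P : Set} (d : Dec P) → ⌊ d ⌋ ≡ true → P
⌊⌋⇒ (yes p) _ = p

⌊⌋-⇔ : {P Q : Set} → P ⇔ Q → (d : Dec P) (e : Dec Q) → ⌊ d ⌋ ≡ ⌊ e ⌋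
⌊⌋-⇔ iff d e = trans (isYes≗does d) (trans (does-⇔ iff d e) (sym (isYes≗does e)))

𝟙 : Bool → ℕ
𝟙 true  = 1
𝟙 false = 0

𝟙-∧ : ∀ a b → 𝟙 (a ∧ b) ≡ 𝟙 a * 𝟙 b
𝟙-∧ true  b = sym (+-identityʳ (𝟙 b))
𝟙-∧ false b = refl

𝟙-mono : ∀ {a b} → (a ≡ true → b ≡ true) → 𝟙 a ≤ 𝟙 b
𝟙-mono {false} _   = z≤n
𝟙-mono {true}  a⇒b rewrite a⇒b refl = ≤-refl

𝟙-*-cong : ∀ a {x y} → (a ≡ true → x ≡ y) → 𝟙 a * x ≡ 𝟙 a * y
𝟙-*-cong false _   = refl
𝟙-*-cong true  x≡y = cong (1 *_) (x≡y refl)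

sumOver : {A : Set} → List A → (A → ℕ) → ℕ
sumOver xs f = sumˡ (map f xs)

countᵇ≡sumOver : {A : Set} (P : A → Bool) (xs : List A) → countᵇ P xs ≡ sumOver xs (𝟙 ∘ P)
countᵇ≡sumOver P [] = refl
countᵇ≡sumOver P (x ∷ xs) with P x
... | true  = cong suc (countᵇ≡sumOver P xs)
... | false = countᵇ≡sumOver P xs

sumOver-cong : {A : Set} (xs : List A) {f g : A → ℕ} → (∀ x → f x ≡ g x) → sumOver xs f ≡ sumOver xs g
sumOver-cong xs f≗g = cong sumˡ (map-cong f≗g xs)

sumOver-map : {A B : Set} (g : A → B) (xs : List A) (f : B → ℕ) → sumOver (map g xs) f ≡ sumOver xs (f ∘ g)
sumOver-map g xs f = cong sumˡ (sym (map-∘ xs))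

sumOver-++ : {A : Set} (xs ys : List A) (f : A → ℕ) → sumOver (xs ++ ys) f ≡ sumOver xs f + sumOver ys f
sumOver-++ xs ys f = trans (cong sumˡ (map-++ f xs ys)) (sum-++ (map f xs) (map f ys))

sumOver-concatMap : {A B : Set} (g : A → List B) (xs : List A) (f : B → ℕ) →
  sumOver (concatMap g xs) f ≡ sumOver xs (λ a → sumOver (g a) f)
sumOver-concatMap g [] f = refl
sumOver-concatMap g (x ∷ xs) f =
  trans (sumOver-++ (g x) (concatMap g xs) f) (cong (sumOver (g x) f +_) (sumOver-concatMap g xs f))

sumOver-+ : {A : Set} (xs : List A) (f g : A → ℕ) → sumOver xs (λ x → f x + g x) ≡ sumOver xs f + sumOver xs g
sumOver-+ [] f g = refl
sumOver-+ (x ∷ xs) f g =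
  trans (cong (f x + g x +_) (sumOver-+ xs f g)) (interchange (f x) (g x) (sumOver xs f) (sumOver xs g))

sumOver-*ˡ : {A : Set} (xs : List A) (c : ℕ) (f : A → ℕ) → sumOver xs (λ x → c * f x) ≡ c * sumOver xs f
sumOver-*ˡ [] c f = sym (*-zeroʳ c)
sumOver-*ˡ (x ∷ xs) c f = trans (cong (c * f x +_) (sumOver-*ˡ xs c f)) (sym (*-distribˡ-+ c (f x) (sumOver xs f)))

sumOver-mono : {A : Set} (xs : List A) {f g : A → ℕ} → (∀ x → f x ≤ g x) → sumOver xs f ≤ sumOver xs g
sumOver-mono [] f≤g = z≤n
sumOver-mono (x ∷ xs) f≤g = +-mono-≤ (f≤g x) (sumOver-mono xs f≤g)

sumOver-zero : {A : Set} (xs : List A) {f : A → ℕ} → (∀ x → f x ≡ 0) → sumOver xs f ≡ 0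
sumOver-zero [] f≗0 = refl
sumOver-zero (x ∷ xs) f≗0 = cong₂ _+_ (f≗0 x) (sumOver-zero xs f≗0)

countᵇ-cong : {A : Set} (xs : List A) {P Q : A → Bool} → (∀ x → P x ≡ Q x) → countᵇ P xs ≡ countᵇ Q xs
countᵇ-cong xs {P} {Q} P≗Q =
  trans (countᵇ≡sumOver P xs) (trans (sumOver-cong xs (cong 𝟙 ∘ P≗Q)) (sym (countᵇ≡sumOver Q xs)))

countᵇ-false : {A : Set} (xs : List A) {P : A → Bool} → (∀ x → P x ≡ false) → countᵇ P xs ≡ 0
countᵇ-false xs {P} P≗false = trans (countᵇ≡sumOver P xs) (sumOver-zero xs (cong 𝟙 ∘ P≗false))

sumOver-comm : {A B : Set} (xs : List A) (ys : List B) (h : A → B → ℕ) →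
  sumOver xs (λ x → sumOver ys (h x)) ≡ sumOver ys (λ y → sumOver xs (λ x → h x y))
sumOver-comm [] ys h = sym (sumOver-zero ys (λ _ → refl))
sumOver-comm (x ∷ xs) ys h =
  trans (cong (sumOver ys (h x) +_) (sumOver-comm xs ys h)) (sym (sumOver-+ ys (h x) _))

sumOver-𝟙∧* : {A : Set} (ys : List A) (b : Bool) (Q : A → Bool) (F : A → ℕ) →
  sumOver ys (λ y → 𝟙 (b ∧ Q y) * F y) ≡ 𝟙 b * sumOver ys (λ y → 𝟙 (Q y) * F y)
sumOver-𝟙∧* ys b Q F = trans (sumOver-cong ys (λ y → trans (cong (_* F y) (𝟙-∧ b (Q y))) (*-assoc (𝟙 b) _ _)))
                             (sumOver-*ˡ ys (𝟙 b) _)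

sumOver-consProduct : {A : Set} {k : ℕ} (xs : List A) (yss : List (Vec A k)) (F : Vec A (suc k) → ℕ) →
  sumOver (concatMap (λ a → map (a ∷_) yss) xs) F ≡ sumOver xs (λ a → sumOver yss (λ v → F (a ∷ v)))
sumOver-consProduct xs yss F =
  trans (sumOver-concatMap _ xs F) (sumOver-cong xs (λ a → sumOver-map (a ∷_) yss F))

sumOver-tabulate : {A : Set} (n : ℕ) (g : Fin n → A) (f : A → ℕ) →
  sumOver (toList (tabulate g)) f ≡ ∑[ i < n ] f (g i)
sumOver-tabulate zero    g f = refl
sumOver-tabulate (suc n) g f = cong (f (g fzero) +_) (sumOver-tabulate n (g ∘ fsuc) f)

sumOver-allFin : (n : ℕ) (f : Fin n → ℕ) → sumOver (toList (allFin n)) f ≡ ∑[ i < n ] f i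
sumOver-allFin n = sumOver-tabulate n (λ i → i)

sumOver-applyUpTo : (N : ℕ) (g f : ℕ → ℕ) → sumOver (applyUpTo g N) f ≡ ∑[ i < N ] f (g (toℕ i))
sumOver-applyUpTo zero    g f = refl
sumOver-applyUpTo (suc N) g f = cong (f (g 0) +_) (sumOver-applyUpTo N (g ∘ suc) f)

∑-const : (n c : ℕ) → ∑[ i < n ] c ≡ n * c
∑-const zero    c = refl
∑-const (suc n) c = cong (c +_) (∑-const n c)

∑-zero : (n : ℕ) {f : Fin n → ℕ} → (∀ i → f i ≡ 0) → sum f ≡ 0
∑-zero n f≗0 = trans (sum-cong-≗ f≗0) (trans (∑-const n 0) (*-zeroʳ n))

∑-*ˡ : (n c : ℕ) (f : Fin n → ℕ) → ∑[ i < n ] (c * f i) ≡ c * sum f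
∑-*ˡ n c f = sym (*-distribˡ-sum c f)

∑-↑ : (m n : ℕ) (f : Fin (m + n) → ℕ) → sum f ≡ ∑[ i < m ] f (i ↑ˡ n) + ∑[ i < n ] f (m ↑ʳ i)
∑-↑ zero    n f = refl
∑-↑ (suc m) n f = trans (cong (f fzero +_) (∑-↑ m n (f ∘ fsuc))) (sym (+-assoc (f fzero) _ _))

∑-combine : (m n : ℕ) (f : Fin (m * n) → ℕ) → sum f ≡ ∑[ i < m ] ∑[ j < n ] f (combine i j)
∑-combine zero    n f = refl
∑-combine (suc m) n f =
  trans (∑-↑ n (m * n) f) (cong (∑[ j < n ] f (j ↑ˡ (m * n)) +_) (∑-combine m n (f ∘ (n ↑ʳ_))))

∑-cast : (m n : ℕ) (eq : m ≡ n) (f : Fin n → ℕ) → sum f ≡ ∑[ i < m ] f (cast eq i)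
∑-cast zero    zero    eq f = refl
∑-cast (suc m) (suc n) eq f = cong (f fzero +_) (∑-cast m n (suc-injective eq) (f ∘ fsuc))

∑-indicator : (N e : ℕ) → e < N → ∑[ i < N ] 𝟙 (toℕ i ≡ᵇ e) ≡ 1
∑-indicator (suc N) zero    _         = cong suc (∑-zero N (λ _ → refl))
∑-indicator (suc N) (suc e) (s≤s e<N) = ∑-indicator N e e<N

combine-divisible⇒zero : {n k : ℕ} (i : Fin n) (j : Fin k) → k ∣ toℕ (combine i j) → toℕ j ≡ 0
combine-divisible⇒zero i fzero    _ = refl
combine-divisible⇒zero {k = k} i (fsuc j) k∣ij = ⊥-elim (<⇒≱ (toℕ<n (fsuc j)) (∣⇒≤ k∣j))
  where
  k∣j : k ∣ suc (toℕ j)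
  k∣j = ∣m+n∣m⇒∣n (subst (k ∣_) (toℕ-combine i (fsuc j)) k∣ij) (m∣m*n (toℕ i))

-- The multiples of k in Fin (n * k) are exactly the combine i z.
∑-multiples : (n k : ℕ) (z : Fin k) → toℕ z ≡ 0 → (f : Fin (n * k) → ℕ) →
  ∑[ a < n * k ] (𝟙 (⌊ k ∣? toℕ a ⌋) * f a) ≡ ∑[ i < n ] f (combine i z)
∑-multiples n (suc k) fzero refl f = trans (∑-combine n (suc k) _) (sum-cong-≗ {n} column)
  where
  column : ∀ i → ∑[ j < suc k ] (𝟙 (⌊ suc k ∣? toℕ (combine i j) ⌋) * f (combine i j)) ≡ f (combine i fzero)
  column i = begin
    𝟙 (⌊ suc k ∣? toℕ (combine i fzero) ⌋) * f (combine i fzero) + ∑[ j < k ] g (fsuc j)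
      ≡⟨ cong₂ _+_ (cong (λ b → 𝟙 b * f (combine i fzero)) (⌊⌋-true (suc k ∣? _) k∣i0))
                   (∑-zero k g[suc]≡0) ⟩
    1 * f (combine i fzero) + 0
      ≡⟨ trans (+-identityʳ _) (*-identityˡ _) ⟩
    f (combine i fzero) ∎
    where
    open ≡-Reasoning
    g : Fin (suc k) → ℕ
    g j = 𝟙 (⌊ suc k ∣? toℕ (combine i j) ⌋) * f (combine i j)
    k∣i0 : suc k ∣ toℕ (combine i fzero)
    k∣i0 = subst (suc k ∣_) (sym (trans (toℕ-combine i fzero) (+-identityʳ _))) (m∣m*n (toℕ i))
    g[suc]≡0 : ∀ j → g (fsuc j) ≡ 0
    g[suc]≡0 j = cong (λ b → 𝟙 b * f (combine i (fsuc j)))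
                      (⌊⌋-false (suc k ∣? _) (1+n≢0 ∘ combine-divisible⇒zero i (fsuc j)))

sumRange-zero : (a b : ℕ) (f : ℕ → ℕ) → (∀ k → a ≤ k → f k ≡ 0) → sumRange a b f ≡ 0
sumRange-zero a b f f≗0 = sumOver-zero (upTo (suc b ∸ a)) (λ d → f≗0 (a + d) (m≤m+n a d))

sumRange-cong : (a b : ℕ) {f g : ℕ → ℕ} → (∀ k → f k ≡ g k) → sumRange a b f ≡ sumRange a b g
sumRange-cong a b f≗g = sumOver-cong (upTo (suc b ∸ a)) (λ d → f≗g (a + d))

sumRange-*ˡ : (a b c : ℕ) (f : ℕ → ℕ) → sumRange a b (λ k → c * f k) ≡ c * sumRange a b f
sumRange-*ˡ a b c f = sumOver-*ˡ (upTo (suc b ∸ a)) c (λ d → f (a + d))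

sumRange-comm : {A : Set} (a b : ℕ) (xs : List A) (h : ℕ → A → ℕ) →
  sumOver xs (λ x → sumRange a b (λ k → h k x)) ≡ sumRange a b (λ k → sumOver xs (h k))
sumRange-comm a b xs h = sumOver-comm xs (upTo (suc b ∸ a)) (λ x d → h (a + d) x)

sumRange-indicator : (a b c : ℕ) → c ≤ b → sumRange a b (λ k → 𝟙 (k ≡ᵇ c)) ≡ 𝟙 (does (a ≤? c))
sumRange-indicator a b c c≤b with a ≤? c
... | no  a≰c = trans (sumRange-zero a b _ (λ k a≤k → cong 𝟙 (≢⇒≡ᵇ λ k≡c → a≰c (subst (a ≤_) k≡c a≤k))))
                      (cong 𝟙 (sym (dec-false (a ≤? c) a≰c)))
... | yes a≤c = begin
  sumOver (upTo (suc b ∸ a)) (λ d → 𝟙 ((a + d) ≡ᵇ c))  ≡⟨ sumOver-applyUpTo (suc b ∸ a) (λ d → d) _ ⟩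
  ∑[ i < suc b ∸ a ] 𝟙 ((a + toℕ i) ≡ᵇ c)            ≡⟨ sum-cong-≗ {suc b ∸ a} shift ⟩
  ∑[ i < suc b ∸ a ] 𝟙 (toℕ i ≡ᵇ (c ∸ a))            ≡⟨ ∑-indicator (suc b ∸ a) (c ∸ a) c∸a<N ⟩
  1                                                 ≡⟨ cong 𝟙 (dec-true (a ≤? c) a≤c) ⟨
  𝟙 (does (a ≤? c))                                 ∎
  where
  open ≡-Reasoning
  c∸a<N : c ∸ a < suc b ∸ a
  c∸a<N = ∸-monoˡ-< (s≤s c≤b) a≤c
  shift : (i : Fin (suc b ∸ a)) → 𝟙 ((a + toℕ i) ≡ᵇ c) ≡ 𝟙 (toℕ i ≡ᵇ (c ∸ a))
  shift i = cong 𝟙 (trans (cong (λ c′ → (a + toℕ i) ≡ᵇ c′) (sym (m+[n∸m]≡n a≤c))) (≡ᵇ-+ a (toℕ i) (c ∸ a)))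

sumOver-allVecs-suc : {Q : ℕ} (k : ℕ) (F : Vec (Fin Q) (suc k) → ℕ) →
  sumOver (allVecs Q (suc k)) F ≡ ∑[ a < Q ] sumOver (allVecs Q k) (λ v → F (a ∷ v))
sumOver-allVecs-suc {Q} k F = trans (sumOver-consProduct (toList (allFin Q)) (allVecs Q k) F) (sumOver-allFin Q _)

sumOver-allVecs-∧ : {Q : ℕ} (k : ℕ) (P : Fin Q → Bool) (R : Vec (Fin Q) k → Bool)
  (F : Vec (Fin Q) (suc k) → Bool) →
  (∀ a v → F (a ∷ v) ≡ (P a ∧ R v)) →
  sumOver (allVecs Q (suc k)) (𝟙 ∘ F) ≡ ∑[ a < Q ] (𝟙 (P a) * sumOver (allVecs Q k) (𝟙 ∘ R))
sumOver-allVecs-∧ {Q} k P R F F≡ = trans (sumOver-allVecs-suc {Q} k (𝟙 ∘ F)) (sum-cong-≗ {Q} factor)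
  where
  factor : ∀ a → sumOver (allVecs Q k) (λ v → 𝟙 (F (a ∷ v))) ≡ 𝟙 (P a) * sumOver (allVecs Q k) (𝟙 ∘ R)
  factor a = trans (sumOver-cong (allVecs Q k) (λ v → trans (cong 𝟙 (F≡ a v)) (𝟙-∧ (P a) (R v))))
                   (sumOver-*ˡ (allVecs Q k) (𝟙 (P a)) (𝟙 ∘ R))

allᵇ-lookup : {A : Set} {n : ℕ} (P : A → Bool) (v : Vec A n) →
  allᵇ P (toList v) ≡ true → ∀ i → P (lookup v i) ≡ true
allᵇ-lookup P (x ∷ v) h fzero    = ∧-conicalˡ (P x) _ h
allᵇ-lookup P (x ∷ v) h (fsuc i) = allᵇ-lookup P v (∧-conicalʳ (P x) _ h) i

allᵇ-intro : {A : Set} {n : ℕ} (P : A → Bool) (v : Vec A n) →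
  (∀ i → P (lookup v i) ≡ true) → allᵇ P (toList v) ≡ true
allᵇ-intro P []      h = refl
allᵇ-intro P (x ∷ v) h rewrite h fzero = allᵇ-intro P v (h ∘ fsuc)

allᵇ-false : {A : Set} {n : ℕ} (P : A → Bool) (v : Vec A n) →
  allᵇ P (toList v) ≡ false → Σ[ i ∈ Fin n ] P (lookup v i) ≡ false
allᵇ-false P (x ∷ v) h with P x in eq
... | false = fzero , eq
... | true  = let i , e = allᵇ-false P v h in fsuc i , e

allᵇ-cong : {A : Set} (xs : List A) {P Q : A → Bool} → (∀ x → P x ≡ Q x) → allᵇ P xs ≡ allᵇ Q xs
allᵇ-cong []       P≗Q = refl
allᵇ-cong (x ∷ xs) P≗Q = cong₂ _∧_ (P≗Q x) (allᵇ-cong xs P≗Q)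

allᵇ-map : {A B : Set} (f : A → B) (xs : List A) (P : B → Bool) → allᵇ P (map f xs) ≡ allᵇ (P ∘ f) xs
allᵇ-map f []       P = refl
allᵇ-map f (x ∷ xs) P = cong (P (f x) ∧_) (allᵇ-map f xs P)

allᵇ-allFin : (m : ℕ) (P : Fin m → Bool) → allᵇ P (toList (allFin m)) ≡ true → ∀ c → P c ≡ true
allᵇ-allFin m P h c = subst (λ c′ → P c′ ≡ true) (lookup-allFin c) (allᵇ-lookup P (allFin m) h c)

allᵇ-allFin-intro : (m : ℕ) (P : Fin m → Bool) → (∀ c → P c ≡ true) → allᵇ P (toList (allFin m)) ≡ true
allᵇ-allFin-intro m P h = allᵇ-intro P (allFin m) (λ i → h (lookup (allFin m) i))

allᵇ-allFin-false : (m : ℕ) (P : Fin m → Bool) →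
  allᵇ P (toList (allFin m)) ≡ false → Σ[ c ∈ Fin m ] P c ≡ false
allᵇ-allFin-false m P h = let i , e = allᵇ-false P (allFin m) h in lookup (allFin m) i , e

leastFalse : {m : ℕ} (d : Fin m → Bool) → Σ[ c ∈ Fin m ] d c ≡ false →
  Σ[ c₀ ∈ Fin m ] (d c₀ ≡ false × (∀ c → toℕ c < toℕ c₀ → d c ≡ true))
leastFalse {suc m} d (c , e) with d fzero in eq₀
leastFalse d (c , e)      | false = fzero , eq₀ , λ _ ()
leastFalse d (fzero , e)  | true  = contradiction (trans (sym eq₀) e) λ ()
leastFalse d (fsuc c , e) | true  =
  let c₀ , e₀ , below = leastFalse (d ∘ fsuc) (c , e) in
  fsuc c₀ , e₀ , λ { fzero _ → eq₀ ; (fsuc c′) (s≤s c′<c₀) → below c′ c′<c₀ }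

rowDivisible : {m q : ℕ} → ℕ → Vec (Fin q) m → Bool
rowDivisible p r = allᵇ (divByᵇ p) (toList r)

allDivisible : {n m q : ℕ} → ℕ → Matrix n m q → Bool
allDivisible p A = allᵇ (rowDivisible p) (toList A)

module Columns (p : ℕ) {n l q : ℕ} (A : Matrix n l q) where

  -- colNonDiv p k A unfolds to not (allᵇ (nonDivAt k) (toList (allFin l))).
  private
    nonDivAt : ℕ → Fin l → Bool
    nonDivAt k c = not (if toℕ c ≡ᵇ k then not (colDiv p A c) else false)

  relPrime≡not-allDivisible : relPrime p A ≡ not (allDivisible p A)
  relPrime≡not-allDivisible =
    cong not (allᵇ-cong (toList A) (λ r → trans (not-involutive _) (allᵇ-cong (toList r) (λ a → not-involutive _))))

  allDivisible⇒colDiv : allDivisible p A ≡ true → ∀ c → colDiv p A c ≡ true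
  allDivisible⇒colDiv h c = allᵇ-intro (λ r → divByᵇ p (lookup r c)) A
    (λ r → allᵇ-lookup (divByᵇ p) (lookup A r) (allᵇ-lookup (rowDivisible p) A h r) c)

  ¬allDivisible⇒¬colDiv : allDivisible p A ≡ false → Σ[ c ∈ Fin l ] colDiv p A c ≡ false
  ¬allDivisible⇒¬colDiv h with allᵇ-false (rowDivisible p) A h
  ... | r , r-nondiv with allᵇ-false (divByᵇ p) (lookup A r) r-nondiv
  ... | c , e = c , ¬colDiv
    where
    ¬colDiv : colDiv p A c ≡ false
    ¬colDiv with colDiv p A c in eq
    ... | false = refl
    ... | true  = contradiction (trans (sym (allᵇ-lookup (λ r → divByᵇ p (lookup r c)) A eq r)) e) λ ()

  colDiv⇒entries : ∀ c → colDiv p A c ≡ true → ∀ r → p ∣ toℕ (lookup (lookup A r) c)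
  colDiv⇒entries c h r = ⌊⌋⇒ (p ∣? _) (allᵇ-lookup (λ r → divByᵇ p (lookup r c)) A h r)

  firstColsDiv-intro : ∀ k → (∀ c → toℕ c < k → colDiv p A c ≡ true) → firstColsDiv p k A ≡ true
  firstColsDiv-intro k h = allᵇ-allFin-intro l _ column
    where
    column : ∀ c → (if toℕ c <ᵇ k then colDiv p A c else true) ≡ true
    column c with toℕ c <ᵇ k in eq
    ... | true  = h c (<ᵇ⇒< (toℕ c) k (subst T (sym eq) _))
    ... | false = refl

  firstColsDiv-elim : ∀ k → firstColsDiv p k A ≡ true → ∀ c → toℕ c < k → colDiv p A c ≡ true
  firstColsDiv-elim k h c c<k with allᵇ-allFin l (λ c → if toℕ c <ᵇ k then colDiv p A c else true) h c
  ... | e rewrite Equivalence.to T-≡ (<⇒<ᵇ c<k) = e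

  colNonDiv-intro : ∀ c → colDiv p A c ≡ false → colNonDiv p (toℕ c) A ≡ true
  colNonDiv-intro c e with allᵇ (nonDivAt (toℕ c)) (toList (allFin l)) in eq
  ... | false = refl
  ... | true with allᵇ-allFin l (nonDivAt (toℕ c)) eq c
  ... | e′ rewrite ≡⇒≡ᵇ {toℕ c} refl | e = contradiction e′ λ ()

  colNonDiv-elim : ∀ k → colNonDiv p k A ≡ true → Σ[ c ∈ Fin l ] (toℕ c ≡ k × colDiv p A c ≡ false)
  colNonDiv-elim k h with allᵇ (nonDivAt k) (toList (allFin l)) in eq
  colNonDiv-elim k () | true
  ... | false with allᵇ-allFin-false l (nonDivAt k) eq
  ... | c , e = c , ≡ᵇ⇒≡ (proj₁ (at c e)) , proj₂ (at c e)
    where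
    at : ∀ c → nonDivAt k c ≡ false → (toℕ c ≡ᵇ k) ≡ true × colDiv p A c ≡ false
    at c e with toℕ c ≡ᵇ k | colDiv p A c
    ... | true  | false = refl , refl
    ... | true  | true  = contradiction e λ ()
    ... | false | _     = contradiction e λ ()

  module FirstNonDivisibleColumn (c₀ : Fin l) (c₀-nonDiv : colDiv p A c₀ ≡ false)
                                 (below : ∀ c → toℕ c < toℕ c₀ → colDiv p A c ≡ true) where

    firstColsDiv≡ : ∀ k → firstColsDiv p k A ≡ does (k ≤? toℕ c₀)
    firstColsDiv≡ k with k ≤? toℕ c₀
    ... | yes k≤c₀ = trans (firstColsDiv-intro k (λ c c<k → below c (<-≤-trans c<k k≤c₀)))
                           (sym (dec-true (k ≤? toℕ c₀) k≤c₀))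
    ... | no  k≰c₀ with firstColsDiv p k A in eq
    ...   | false = sym (dec-false (k ≤? toℕ c₀) k≰c₀)
    ...   | true  = contradiction (trans (sym c₀-nonDiv) (firstColsDiv-elim k eq c₀ (≰⇒> k≰c₀))) λ ()

    colNonDiv-< : ∀ k → k < toℕ c₀ → colNonDiv p k A ≡ false
    colNonDiv-< k k<c₀ with colNonDiv p k A in eq
    ... | false = refl
    ... | true with colNonDiv-elim k eq
    ...   | c , c≡k , c-nonDiv =
      contradiction (trans (sym c-nonDiv) (below c (subst (_< toℕ c₀) (sym c≡k) k<c₀))) λ ()

    firstColsDiv∧colNonDiv : ∀ k → (firstColsDiv p k A ∧ colNonDiv p k A) ≡ (k ≡ᵇ toℕ c₀)
    firstColsDiv∧colNonDiv k with <-cmp k (toℕ c₀)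
    ... | tri< k<c₀ _ _ rewrite colNonDiv-< k k<c₀ = trans (∧-zeroʳ _) (sym (≢⇒≡ᵇ (<⇒≢ k<c₀)))
    ... | tri≈ _ refl _ rewrite firstColsDiv≡ k | dec-true (k ≤? k) ≤-refl | colNonDiv-intro c₀ c₀-nonDiv =
      sym (≡⇒≡ᵇ {k} refl)
    ... | tri> _ _ c₀<k rewrite firstColsDiv≡ k | dec-false (k ≤? toℕ c₀) (<⇒≱ c₀<k) =
      sym (≢⇒≡ᵇ (≢-sym (<⇒≢ c₀<k)))

0F : (k : ℕ) .{{_ : NonZero k}} → Fin k
0F (suc k) = fzero

toℕ-0F : (k : ℕ) .{{_ : NonZero k}} → toℕ (0F k) ≡ 0
toℕ-0F (suc k) = refl

mixedDot : {a b k : ℕ} → Vec (Fin a) k → Vec (Fin b) k → ℕ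
mixedDot []      []      = 0
mixedDot (u ∷ r) (v ∷ x) = toℕ u * toℕ v + mixedDot r x

dot-divisible : {d q k : ℕ} (r x : Vec (Fin q) k) →
  (∀ c → d ∣ toℕ (lookup r c) * toℕ (lookup x c)) → d ∣ dot r x
dot-divisible {d} []      []      _ = d ∣0
dot-divisible     (u ∷ r) (v ∷ x) h = ∣m∣n⇒∣m+n (h fzero) (dot-divisible r x (h ∘ fsuc))

-- Z_q with q = p q′ sits over Z_q′ in two ways: reduction mod q′, and multiplication by p from Z_q′ onto pZ_q.
module Lifting (p q′ : ℕ) .{{_ : NonZero p}} .{{_ : NonZero q′}} where

  q : ℕ
  q = p * q′

  reduce : Fin q → Fin q′
  reduce a = proj₂ (remQuot {p} q′ a)

  scale : Fin q′ → Fin q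
  scale b = cast (*-comm q′ p) (combine b (0F p))

  scaleᴹ : {n m : ℕ} → Matrix n m q′ → Matrix n m q
  scaleᴹ = V.map (V.map scale)

  toℕ-scale : ∀ b → toℕ (scale b) ≡ p * toℕ b
  toℕ-scale b = begin
    toℕ (cast _ (combine b (0F p)))  ≡⟨ toℕ-cast (*-comm q′ p) (combine b (0F p)) ⟩
    toℕ (combine b (0F p))           ≡⟨ toℕ-combine b (0F p) ⟩
    p * toℕ b + toℕ (0F p)           ≡⟨ cong (p * toℕ b +_) (toℕ-0F p) ⟩
    p * toℕ b + 0                    ≡⟨ +-identityʳ _ ⟩
    p * toℕ b                        ∎
    where open ≡-Reasoning

  toℕ-reduce-mod : ∀ a → toℕ a % q′ ≡ toℕ (reduce a) % q′
  toℕ-reduce-mod a = begin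
    toℕ a % q′                       ≡⟨ cong (λ a′ → toℕ a′ % q′) (sym (combine-remQuot {p} q′ a)) ⟩
    toℕ (combine i j) % q′           ≡⟨ cong (_% q′) (trans (toℕ-combine i j) (+-comm (q′ * toℕ i) (toℕ j))) ⟩
    (toℕ j + q′ * toℕ i) % q′        ≡⟨ cong (λ t → (toℕ j + t) % q′) (*-comm q′ (toℕ i)) ⟩
    (toℕ j + toℕ i * q′) % q′        ≡⟨ [m+kn]%n≡m%n (toℕ j) (toℕ i) q′ ⟩
    toℕ j % q′                       ∎
    where
    open ≡-Reasoning
    i = proj₁ (remQuot {p} q′ a)
    j = proj₂ (remQuot {p} q′ a)

  ∑-reduce : (G : Fin q′ → ℕ) → ∑[ a < q ] G (reduce a) ≡ p * sum G
  ∑-reduce G = begin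
    ∑[ a < q ] G (reduce a)                       ≡⟨ ∑-combine p q′ _ ⟩
    ∑[ i < p ] ∑[ j < q′ ] G (reduce (combine i j))
      ≡⟨ sum-cong-≗ {p} (λ i → sum-cong-≗ {q′} (λ j → cong G (cong proj₂ (remQuot-combine i j)))) ⟩
    ∑[ i < p ] sum G                              ≡⟨ ∑-const p (sum G) ⟩
    p * sum G                                     ∎
    where open ≡-Reasoning

  ∑-divisible : (f : Fin q → ℕ) → ∑[ a < q ] (𝟙 (divByᵇ p a) * f a) ≡ ∑[ b < q′ ] f (scale b)
  ∑-divisible f = begin
    ∑[ a < q ] (𝟙 (divByᵇ p a) * f a)
      ≡⟨ ∑-cast (q′ * p) q (*-comm q′ p) _ ⟩
    ∑[ a < q′ * p ] (𝟙 (divByᵇ p (cast _ a)) * f (cast _ a))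
      ≡⟨ sum-cong-≗ {q′ * p} (λ a → cong (λ t → 𝟙 ⌊ p ∣? t ⌋ * f (cast _ a))
                                         (toℕ-cast (*-comm q′ p) a)) ⟩
    ∑[ a < q′ * p ] (𝟙 ⌊ p ∣? toℕ a ⌋ * f (cast _ a))
      ≡⟨ ∑-multiples q′ p (0F p) (toℕ-0F p) _ ⟩
    ∑[ b < q′ ] f (scale b) ∎
    where open ≡-Reasoning

  sumOver-reduce : ∀ k (F : Vec (Fin q′) k → ℕ) →
    sumOver (allVecs q k) (F ∘ V.map reduce) ≡ p ^ k * sumOver (allVecs q′ k) F
  sumOver-reduce zero    F = sym (*-identityˡ _)
  sumOver-reduce (suc k) F = begin
    sumOver (allVecs q (suc k)) (F ∘ V.map reduce)
      ≡⟨ sumOver-allVecs-suc {q} k (F ∘ V.map reduce) ⟩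
    ∑[ a < q ] sumOver (allVecs q k) (λ v → F (reduce a ∷ V.map reduce v))
      ≡⟨ sum-cong-≗ {q} (λ a → sumOver-reduce k (λ w → F (reduce a ∷ w))) ⟩
    ∑[ a < q ] G (reduce a)
      ≡⟨ ∑-reduce G ⟩
    p * ∑[ b < q′ ] (p ^ k * sumOver (allVecs q′ k) (λ w → F (b ∷ w)))
      ≡⟨ cong (p *_) (∑-*ˡ q′ (p ^ k) _) ⟩
    p * (p ^ k * ∑[ b < q′ ] sumOver (allVecs q′ k) (λ w → F (b ∷ w)))
      ≡⟨ cong (λ t → p * (p ^ k * t)) (sym (sumOver-allVecs-suc {q′} k F)) ⟩
    p * (p ^ k * sumOver (allVecs q′ (suc k)) F)
      ≡⟨ sym (*-assoc p (p ^ k) _) ⟩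
    p ^ suc k * sumOver (allVecs q′ (suc k)) F ∎
    where
    open ≡-Reasoning
    G : Fin q′ → ℕ
    G b = p ^ k * sumOver (allVecs q′ k) (λ w → F (b ∷ w))

  sumOver-rowDivisible : ∀ k (F : Vec (Fin q) k → ℕ) →
    sumOver (allVecs q k) (λ v → 𝟙 (rowDivisible p v) * F v) ≡ sumOver (allVecs q′ k) (F ∘ V.map scale)
  sumOver-rowDivisible zero    F = cong (_+ 0) (*-identityˡ _)
  sumOver-rowDivisible (suc k) F = begin
    sumOver (allVecs q (suc k)) (λ v → 𝟙 (rowDivisible p v) * F v)
      ≡⟨ sumOver-allVecs-suc {q} k _ ⟩
    ∑[ a < q ] sumOver (allVecs q k) (λ v → 𝟙 (divByᵇ p a ∧ rowDivisible p v) * F (a ∷ v))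
      ≡⟨ sum-cong-≗ {q} (λ a → sumOver-𝟙∧* (allVecs q k) (divByᵇ p a) (rowDivisible p) (F ∘ (a ∷_))) ⟩
    ∑[ a < q ] (𝟙 (divByᵇ p a) * sumOver (allVecs q k) (λ v → 𝟙 (rowDivisible p v) * F (a ∷ v)))
      ≡⟨ sum-cong-≗ {q} (λ a → cong (𝟙 (divByᵇ p a) *_) (sumOver-rowDivisible k (F ∘ (a ∷_)))) ⟩
    ∑[ a < q ] (𝟙 (divByᵇ p a) * sumOver (allVecs q′ k) (λ w → F (a ∷ V.map scale w)))
      ≡⟨ ∑-divisible _ ⟩
    ∑[ b < q′ ] sumOver (allVecs q′ k) (λ w → F (scale b ∷ V.map scale w))
      ≡⟨ sym (sumOver-allVecs-suc {q′} k (F ∘ V.map scale)) ⟩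
    sumOver (allVecs q′ (suc k)) (F ∘ V.map scale) ∎
    where open ≡-Reasoning

  sumOver-allDivisible : ∀ n m (F : Matrix n m q → ℕ) →
    sumOver (allMatrices n m q) (λ A → 𝟙 (allDivisible p A) * F A) ≡ sumOver (allMatrices n m q′) (F ∘ scaleᴹ)
  sumOver-allDivisible zero    m F = cong (_+ 0) (*-identityˡ _)
  sumOver-allDivisible (suc n) m F = begin
    sumOver (allMatrices (suc n) m q) (λ A → 𝟙 (allDivisible p A) * F A)
      ≡⟨ sumOver-consProduct (allVecs q m) (allMatrices n m q) _ ⟩
    sumOver (allVecs q m) (λ r → sumOver (allMatrices n m q)
                                         (λ A → 𝟙 (rowDivisible p r ∧ allDivisible p A) * F (r ∷ A)))
      ≡⟨ sumOver-cong (allVecs q m) (λ r →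
           sumOver-𝟙∧* (allMatrices n m q) (rowDivisible p r) (allDivisible p) (F ∘ (r ∷_))) ⟩
    sumOver (allVecs q m) (λ r → 𝟙 (rowDivisible p r) * sumOver (allMatrices n m q)
                                                              (λ A → 𝟙 (allDivisible p A) * F (r ∷ A)))
      ≡⟨ sumOver-cong (allVecs q m) (λ r →
           cong (𝟙 (rowDivisible p r) *_) (sumOver-allDivisible n m (F ∘ (r ∷_)))) ⟩
    sumOver (allVecs q m) (λ r → 𝟙 (rowDivisible p r) * sumOver (allMatrices n m q′) (λ B → F (r ∷ scaleᴹ B)))
      ≡⟨ sumOver-rowDivisible m _ ⟩
    sumOver (allVecs q′ m) (λ w → sumOver (allMatrices n m q′) (λ B → F (V.map scale w ∷ scaleᴹ B)))
      ≡⟨ sym (sumOver-consProduct (allVecs q′ m) (allMatrices n m q′) (F ∘ scaleᴹ)) ⟩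
    sumOver (allMatrices (suc n) m q′) (F ∘ scaleᴹ) ∎
    where open ≡-Reasoning

  dot-scale : ∀ {k} (r : Vec (Fin q′) k) (x : Vec (Fin q) k) → dot (V.map scale r) x ≡ p * mixedDot r x
  dot-scale []      []      = sym (*-zeroʳ p)
  dot-scale (u ∷ r) (v ∷ x) = begin
    toℕ (scale u) * toℕ v + dot (V.map scale r) x
      ≡⟨ cong₂ (λ s t → s * toℕ v + t) (toℕ-scale u) (dot-scale r x) ⟩
    p * toℕ u * toℕ v + p * mixedDot r x           ≡⟨ cong (_+ p * mixedDot r x) (*-assoc p (toℕ u) (toℕ v)) ⟩
    p * (toℕ u * toℕ v) + p * mixedDot r x         ≡⟨ sym (*-distribˡ-+ p _ _) ⟩
    p * (toℕ u * toℕ v + mixedDot r x)             ∎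
    where open ≡-Reasoning

  dot-reduce : ∀ {k} (r : Vec (Fin q′) k) (x : Vec (Fin q) k) → dot r (V.map reduce x) % q′ ≡ mixedDot r x % q′
  dot-reduce []      []      = refl
  dot-reduce (u ∷ r) (v ∷ x) = begin
    (toℕ u * toℕ (reduce v) + dot r (V.map reduce x)) % q′
      ≡⟨ %-distribˡ-+ (toℕ u * toℕ (reduce v)) _ q′ ⟩
    ((toℕ u * toℕ (reduce v)) % q′ + dot r (V.map reduce x) % q′) % q′
      ≡⟨ cong₂ (λ s t → (s + t) % q′) head-mod (dot-reduce r x) ⟩
    ((toℕ u * toℕ v) % q′ + mixedDot r x % q′) % q′
      ≡⟨ sym (%-distribˡ-+ (toℕ u * toℕ v) _ q′) ⟩
    (toℕ u * toℕ v + mixedDot r x) % q′ ∎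
    where
    open ≡-Reasoning
    head-mod : (toℕ u * toℕ (reduce v)) % q′ ≡ (toℕ u * toℕ v) % q′
    head-mod = trans (%-distribˡ-* (toℕ u) (toℕ (reduce v)) q′)
      (trans (cong (λ t → ((toℕ u % q′) * t) % q′) (sym (toℕ-reduce-mod v)))
             (sym (%-distribˡ-* (toℕ u) (toℕ v) q′)))

  -- p r · x ≡ 0 (mod p q′) iff r · x ≡ 0 (mod q′), and r · x only depends on x mod q′.
  rowSolves-scale : ∀ {k} (r : Vec (Fin q′) k) (x : Vec (Fin q) k) →
    ⌊ q ∣? dot (V.map scale r) x ⌋ ≡ ⌊ q′ ∣? dot r (V.map reduce x) ⌋
  rowSolves-scale r x = ⌊⌋-⇔ (mk⇔ to from) (q ∣? _) (q′ ∣? _)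
    where
    to : q ∣ dot (V.map scale r) x → q′ ∣ dot r (V.map reduce x)
    to h = m%n≡0⇒n∣m _ q′ (trans (dot-reduce r x)
                                 (n∣m⇒m%n≡0 _ q′ (*-cancelˡ-∣ p (subst (q ∣_) (dot-scale r x) h))))
    from : q′ ∣ dot r (V.map reduce x) → q ∣ dot (V.map scale r) x
    from h = subst (q ∣_) (sym (dot-scale r x))
                   (*-monoʳ-∣ p (m%n≡0⇒n∣m _ q′ (trans (sym (dot-reduce r x)) (n∣m⇒m%n≡0 _ q′ h))))

  isSolution-scale : ∀ {n m} (B : Matrix n m q′) (x : Vec (Fin q) m) →
    isSolution (scaleᴹ B) x ≡ isSolution B (V.map reduce x)
  isSolution-scale B x = begin
    allᵇ (λ r → ⌊ q ∣? dot r x ⌋) (toList (V.map (V.map scale) B))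
      ≡⟨ cong (allᵇ _) (toList-map (V.map scale) B) ⟩
    allᵇ (λ r → ⌊ q ∣? dot r x ⌋) (map (V.map scale) (toList B))
      ≡⟨ allᵇ-map (V.map scale) (toList B) _ ⟩
    allᵇ (λ r → ⌊ q ∣? dot (V.map scale r) x ⌋) (toList B)
      ≡⟨ allᵇ-cong (toList B) (λ r → rowSolves-scale r x) ⟩
    allᵇ (λ r → ⌊ q′ ∣? dot r (V.map reduce x) ⌋) (toList B) ∎
    where open ≡-Reasoning

  numSolutions-scale : ∀ {n m} (B : Matrix n m q′) → numSolutions (scaleᴹ B) ≡ p ^ m * numSolutions B
  numSolutions-scale {m = m} B = begin
    countᵇ (isSolution (scaleᴹ B)) (allVecs q m)
      ≡⟨ countᵇ≡sumOver _ (allVecs q m) ⟩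
    sumOver (allVecs q m) (𝟙 ∘ isSolution (scaleᴹ B))
      ≡⟨ sumOver-cong (allVecs q m) (cong 𝟙 ∘ isSolution-scale B) ⟩
    sumOver (allVecs q m) (𝟙 ∘ isSolution B ∘ V.map reduce)
      ≡⟨ sumOver-reduce m _ ⟩
    p ^ m * sumOver (allVecs q′ m) (𝟙 ∘ isSolution B)
      ≡⟨ cong (p ^ m *_) (countᵇ≡sumOver _ (allVecs q′ m)) ⟨
    p ^ m * countᵇ (isSolution B) (allVecs q′ m) ∎
    where open ≡-Reasoning

  private instance
    q≢0 : NonZero q
    q≢0 = m*n≢0 p q′

  prefixMultipleᵇ : ℕ → ∀ {l} → Vec (Fin q) l → Bool
  prefixMultipleᵇ k       []      = true
  prefixMultipleᵇ zero    (a ∷ v) = (toℕ a ≡ᵇ 0) ∧ prefixMultipleᵇ zero v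
  prefixMultipleᵇ (suc k) (a ∷ v) = ⌊ q′ ∣? toℕ a ⌋ ∧ prefixMultipleᵇ k v

  count-prefixMultiple : ∀ l k → k ≤ l → sumOver (allVecs q l) (𝟙 ∘ prefixMultipleᵇ k) ≡ p ^ k
  count-prefixMultiple zero    zero    _         = refl
  count-prefixMultiple (suc l) zero    _         = begin
    sumOver (allVecs q (suc l)) (𝟙 ∘ prefixMultipleᵇ 0)
      ≡⟨ sumOver-allVecs-∧ l (λ a → toℕ a ≡ᵇ 0) (prefixMultipleᵇ 0) _ (λ _ _ → refl) ⟩
    ∑[ a < q ] (𝟙 (toℕ a ≡ᵇ 0) * sumOver (allVecs q l) (𝟙 ∘ prefixMultipleᵇ 0))
      ≡⟨ sum-cong-≗ {q} (λ a → trans (cong (𝟙 (toℕ a ≡ᵇ 0) *_) (count-prefixMultiple l 0 z≤n))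
                                     (*-identityʳ _)) ⟩
    ∑[ a < q ] 𝟙 (toℕ a ≡ᵇ 0)
      ≡⟨ ∑-indicator q 0 (>-nonZero⁻¹ q) ⟩
    1 ∎
    where open ≡-Reasoning
  count-prefixMultiple (suc l) (suc k) (s≤s k≤l) = begin
    sumOver (allVecs q (suc l)) (𝟙 ∘ prefixMultipleᵇ (suc k))
      ≡⟨ sumOver-allVecs-∧ l (λ a → ⌊ q′ ∣? toℕ a ⌋) (prefixMultipleᵇ k) _ (λ _ _ → refl) ⟩
    ∑[ a < q ] (𝟙 ⌊ q′ ∣? toℕ a ⌋ * sumOver (allVecs q l) (𝟙 ∘ prefixMultipleᵇ k))
      ≡⟨ sum-cong-≗ {q} (λ a → cong (𝟙 ⌊ q′ ∣? toℕ a ⌋ *_) (count-prefixMultiple l k k≤l)) ⟩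
    ∑[ a < q ] (𝟙 ⌊ q′ ∣? toℕ a ⌋ * p ^ k)
      ≡⟨ ∑-multiples p q′ (0F q′) (toℕ-0F q′) (λ _ → p ^ k) ⟩
    ∑[ i < p ] (p ^ k)
      ≡⟨ ∑-const p (p ^ k) ⟩
    p ^ suc k ∎
    where open ≡-Reasoning

  prefixMultiple-entries : ∀ {l} k (x : Vec (Fin q) l) → prefixMultipleᵇ k x ≡ true → ∀ c →
    (toℕ c < k → q′ ∣ toℕ (lookup x c)) × (k ≤ toℕ c → toℕ (lookup x c) ≡ 0)
  prefixMultiple-entries zero    (a ∷ v) h fzero    = (λ ()) , λ _ → ≡ᵇ⇒≡ (∧-conicalˡ _ _ h)
  prefixMultiple-entries zero    (a ∷ v) h (fsuc c) =
    (λ ()) , λ _ → proj₂ (prefixMultiple-entries zero v (∧-conicalʳ _ _ h) c) z≤n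
  prefixMultiple-entries (suc k) (a ∷ v) h fzero    = (λ _ → ⌊⌋⇒ (q′ ∣? toℕ a) (∧-conicalˡ _ _ h)) , λ ()
  prefixMultiple-entries (suc k) (a ∷ v) h (fsuc c) =
    let below , above = prefixMultiple-entries k v (∧-conicalʳ _ _ h) c in
    (λ { (s≤s c<k) → below c<k }) , (λ { (s≤s k≤c) → above k≤c })

  -- Each term of A x pairs a multiple of p from the first k columns with a multiple of q′, or with 0.
  prefixMultiple-isSolution : ∀ {n l} k (A : Matrix n l q) (x : Vec (Fin q) l) →
    firstColsDiv p k A ≡ true → prefixMultipleᵇ k x ≡ true → isSolution A x ≡ true
  prefixMultiple-isSolution k A x A-div x-pre =
    allᵇ-intro (λ r → ⌊ q ∣? dot r x ⌋) A (λ r → ⌊⌋-true (q ∣? _) (dot-divisible (lookup A r) x (term r)))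
    where
    open Columns p A
    term : ∀ r c → q ∣ toℕ (lookup (lookup A r) c) * toℕ (lookup x c)
    term r c with toℕ c <? k
    ... | yes c<k = *-pres-∣ (colDiv⇒entries c (firstColsDiv-elim k A-div c c<k) r)
                             (proj₁ (prefixMultiple-entries k x x-pre c) c<k)
    ... | no  c≮k = subst (λ t → q ∣ toℕ (lookup (lookup A r) c) * t)
                          (sym (proj₂ (prefixMultiple-entries k x x-pre c) (≮⇒≥ c≮k)))
                          (subst (q ∣_) (sym (*-zeroʳ (toℕ (lookup (lookup A r) c)))) (q ∣0))

  numSolutions-≥ : ∀ {n l} k (A : Matrix n l q) → firstColsDiv p k A ≡ true → k ≤ l → p ^ k ≤ numSolutions A
  numSolutions-≥ {l = l} k A A-div k≤l = begin
    p ^ k                                           ≡⟨ count-prefixMultiple l k k≤l ⟨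
    sumOver (allVecs q l) (𝟙 ∘ prefixMultipleᵇ k)   ≤⟨ sumOver-mono (allVecs q l) prefix≤solution ⟩
    sumOver (allVecs q l) (𝟙 ∘ isSolution A)        ≡⟨ countᵇ≡sumOver (isSolution A) (allVecs q l) ⟨
    numSolutions A                                  ∎
    where
    open ≤-Reasoning
    prefix≤solution : ∀ x → 𝟙 (prefixMultipleᵇ k x) ≤ 𝟙 (isSolution A x)
    prefix≤solution x = 𝟙-mono (prefixMultiple-isSolution k A x A-div)

^-cancelʳ-≤ : ∀ p {c d} → 1 < p → p ^ c ≤ p ^ d → c ≤ d
^-cancelʳ-≤ p p>1 le = ≮⇒≥ (λ d<c → <⇒≱ (^-monoʳ-< p p>1 d<c) le)

E-negative : ∀ n m p t d → 0 < d → E n m p t (ℤ.- ℤ.+ d) ≡ 0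
E-negative n m p t (suc d) _ = refl

countᵇ-scaledSolutions : ∀ n m p t j → 1 < p →
  countᵇ (λ B → (p ^ m * numSolutions B) ≡ᵇ (p ^ j)) (allMatrices n m (p ^ t)) ≡ E n m p t (ℤ.+ j ℤ.- ℤ.+ m)
countᵇ-scaledSolutions n m p t j p>1 with m ≤? j
... | yes m≤j = trans (countᵇ-cong (allMatrices n m (p ^ t)) (λ B → ≡ᵇ-⇔ (cancel (numSolutions B))))
                      (cong (E n m p t) (sym (trans (m-n≡m⊖n j m) (⊖-≥ m≤j))))
  where
  instance _ = >-nonZero (<-trans z<s p>1)
  p^j≡ : p ^ j ≡ p ^ m * p ^ (j ∸ m)
  p^j≡ = trans (cong (p ^_) (sym (m+[n∸m]≡n m≤j))) (^-distribˡ-+-* p m (j ∸ m))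
  cancel : ∀ x → p ^ m * x ≡ p ^ j ⇔ x ≡ p ^ (j ∸ m)
  cancel x = mk⇔ (λ eq → *-cancelˡ-≡ x (p ^ (j ∸ m)) (p ^ m) {{m^n≢0 p m}} (trans eq p^j≡))
                 (λ eq → trans (cong (p ^ m *_) eq) (sym p^j≡))
... | no  m≰j = trans (countᵇ-false (allMatrices n m (p ^ t)) (λ B → ≢⇒≡ᵇ (mismatch (numSolutions B))))
                      (sym (trans (cong (E n m p t) (trans (m-n≡m⊖n j m) (⊖-< j<m)))
                                  (E-negative n m p t (m ∸ j) (m<n⇒0<n∸m j<m))))
  where
  instance _ = >-nonZero (<-trans z<s p>1)
  j<m : j < m
  j<m = ≰⇒> m≰j
  mismatch : ∀ x → p ^ m * x ≢ p ^ j
  mismatch zero    eq = <⇒≢ (m^n>0 p j) (trans (sym (*-zeroʳ (p ^ m))) eq)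
  mismatch (suc x) eq = <⇒≱ (^-monoʳ-< p p>1 j<m) (subst (p ^ m ≤_) eq (m≤m*n (p ^ m) (suc x)))

module Decomposition (p q′ : ℕ) .{{_ : NonZero p}} .{{_ : NonZero q′}} (p>1 : 1 < p)
                     (n m i j : ℕ) (i≤m-1 : i ≤ m ∸ 1) where

  open Lifting p q′

  kmax : ℕ
  kmax = j ⊓ (m ∸ 1)

  hasPʲSolutionsᵇ : Matrix n m q → Bool
  hasPʲSolutionsᵇ A = numSolutions A ≡ᵇ (p ^ j)

  inEᵢᵇ : Matrix n m q → Bool
  inEᵢᵇ A = hasPʲSolutionsᵇ A ∧ firstColsDiv p i A

  inẼᵇ : ℕ → Matrix n m q → Bool
  inẼᵇ k A = (numSolutions A ≡ᵇ (p ^ j)) ∧ relPrime p A ∧ firstColsDiv p k A ∧ colNonDiv p k A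

  scaledHasPʲSolutionsᵇ : Matrix n m q′ → Bool
  scaledHasPʲSolutionsᵇ B = (p ^ m * numSolutions B) ≡ᵇ (p ^ j)

  Ẽ-terms : Matrix n m q → ℕ
  Ẽ-terms A = sumRange i kmax (λ k → 𝟙 (inẼᵇ k A))

  indicator-split-allDivisible : ∀ A → allDivisible p A ≡ true →
    𝟙 (inEᵢᵇ A) ≡ 𝟙 (hasPʲSolutionsᵇ A) + Ẽ-terms A
  indicator-split-allDivisible A A-div = begin
    𝟙 (hasPʲSolutionsᵇ A ∧ firstColsDiv p i A)  ≡⟨ cong (λ t → 𝟙 (hasPʲSolutionsᵇ A ∧ t)) A-firstCols ⟩
    𝟙 (hasPʲSolutionsᵇ A ∧ true)                ≡⟨ cong 𝟙 (∧-identityʳ _) ⟩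
    𝟙 (hasPʲSolutionsᵇ A)                       ≡⟨ +-identityʳ _ ⟨
    𝟙 (hasPʲSolutionsᵇ A) + 0                   ≡⟨ cong (𝟙 (hasPʲSolutionsᵇ A) +_) (sumRange-zero i kmax _ no-Ẽ) ⟨
    𝟙 (hasPʲSolutionsᵇ A) + Ẽ-terms A           ∎
    where
    open ≡-Reasoning
    open Columns p A
    A-firstCols : firstColsDiv p i A ≡ true
    A-firstCols = firstColsDiv-intro i (λ c _ → allDivisible⇒colDiv A-div c)
    no-Ẽ : ∀ k → i ≤ k → 𝟙 (inẼᵇ k A) ≡ 0
    no-Ẽ k _ rewrite relPrime≡not-allDivisible | A-div = cong 𝟙 (∧-zeroʳ _)

  indicator-split-notAllDivisible : ∀ A → allDivisible p A ≡ false → 𝟙 (inEᵢᵇ A) ≡ Ẽ-terms A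
  indicator-split-notAllDivisible A A-nonDiv = begin
    𝟙 (hasPʲSolutionsᵇ A ∧ firstColsDiv p i A)       ≡⟨ 𝟙-∧ has (firstColsDiv p i A) ⟩
    𝟙 has * 𝟙 (firstColsDiv p i A)                   ≡⟨ 𝟙-*-cong has firstCols≡range ⟩
    𝟙 has * sumRange i kmax (λ k → 𝟙 (k ≡ᵇ c))       ≡⟨ sumRange-*ˡ i kmax (𝟙 has) (𝟙 ∘ (_≡ᵇ c)) ⟨
    sumRange i kmax (λ k → 𝟙 has * 𝟙 (k ≡ᵇ c))       ≡⟨ sumRange-cong i kmax inẼ≡ ⟨
    Ẽ-terms A                                        ∎
    where
    open ≡-Reasoning
    open Columns p A
    has = hasPʲSolutionsᵇ A
    first : Σ[ c₀ ∈ Fin m ] (colDiv p A c₀ ≡ false × ∀ c′ → toℕ c′ < toℕ c₀ → colDiv p A c′ ≡ true)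
    first = leastFalse (colDiv p A) (¬allDivisible⇒¬colDiv A-nonDiv)
    c₀ = proj₁ first
    c = toℕ c₀
    open FirstNonDivisibleColumn c₀ (proj₁ (proj₂ first)) (proj₂ (proj₂ first))
    relPrime-A : relPrime p A ≡ true
    relPrime-A = trans relPrime≡not-allDivisible (cong not A-nonDiv)
    inẼ≡ : ∀ k → 𝟙 (inẼᵇ k A) ≡ 𝟙 has * 𝟙 (k ≡ᵇ c)
    inẼ≡ k = begin
      𝟙 (has ∧ relPrime p A ∧ firstColsDiv p k A ∧ colNonDiv p k A)
        ≡⟨ cong (λ t → 𝟙 (has ∧ t ∧ firstColsDiv p k A ∧ colNonDiv p k A)) relPrime-A ⟩
      𝟙 (has ∧ firstColsDiv p k A ∧ colNonDiv p k A)
        ≡⟨ cong (λ t → 𝟙 (has ∧ t)) (firstColsDiv∧colNonDiv k) ⟩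
      𝟙 (has ∧ (k ≡ᵇ c))
        ≡⟨ 𝟙-∧ has (k ≡ᵇ c) ⟩
      𝟙 has * 𝟙 (k ≡ᵇ c) ∎
    -- A has at least p^c solutions, so when it has exactly p^j of them, c ≤ j.
    firstCols≡range : has ≡ true → 𝟙 (firstColsDiv p i A) ≡ sumRange i kmax (λ k → 𝟙 (k ≡ᵇ c))
    firstCols≡range has-true =
      trans (cong 𝟙 (firstColsDiv≡ i)) (sym (sumRange-indicator i kmax c (⊓-glb c≤j (<⇒≤pred (toℕ<n c₀)))))
      where
      p^c≤solutions : p ^ c ≤ numSolutions A
      p^c≤solutions = numSolutions-≥ c A (firstColsDiv-intro c (proj₂ (proj₂ first))) (<⇒≤ (toℕ<n c₀))
      c≤j : c ≤ j
      c≤j = ^-cancelʳ-≤ p p>1 (subst (p ^ c ≤_) (≡ᵇ⇒≡ has-true) p^c≤solutions)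

  indicator-split : ∀ A → 𝟙 (inEᵢᵇ A) ≡ 𝟙 (allDivisible p A) * 𝟙 (hasPʲSolutionsᵇ A) + Ẽ-terms A
  indicator-split A with allDivisible p A in eq
  ... | true  = trans (indicator-split-allDivisible A eq) (cong (_+ Ẽ-terms A) (sym (*-identityˡ _)))
  ... | false = indicator-split-notAllDivisible A eq

  count-split : countᵇ inEᵢᵇ (allMatrices n m q)
              ≡ countᵇ scaledHasPʲSolutionsᵇ (allMatrices n m q′)
                + sumRange i kmax (λ k → countᵇ (inẼᵇ k) (allMatrices n m q))
  count-split = begin
    countᵇ inEᵢᵇ L
      ≡⟨ countᵇ≡sumOver inEᵢᵇ L ⟩
    sumOver L (𝟙 ∘ inEᵢᵇ)
      ≡⟨ sumOver-cong L indicator-split ⟩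
    sumOver L (λ A → 𝟙 (allDivisible p A) * 𝟙 (hasPʲSolutionsᵇ A) + Ẽ-terms A)
      ≡⟨ sumOver-+ L _ Ẽ-terms ⟩
    sumOver L (λ A → 𝟙 (allDivisible p A) * 𝟙 (hasPʲSolutionsᵇ A)) + sumOver L Ẽ-terms
      ≡⟨ cong₂ _+_ (sumOver-allDivisible n m (𝟙 ∘ hasPʲSolutionsᵇ))
                   (sumRange-comm i kmax L (λ k → 𝟙 ∘ inẼᵇ k)) ⟩
    sumOver L′ (λ B → 𝟙 (hasPʲSolutionsᵇ (scaleᴹ B))) + sumRange i kmax (λ k → sumOver L (𝟙 ∘ inẼᵇ k))
      ≡⟨ cong₂ _+_ (sumOver-cong L′ (λ B → cong (λ t → 𝟙 (t ≡ᵇ (p ^ j))) (numSolutions-scale B)))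
                   (sumRange-cong i kmax (λ k → sym (countᵇ≡sumOver (inẼᵇ k) L))) ⟩
    sumOver L′ (𝟙 ∘ scaledHasPʲSolutionsᵇ) + sumRange i kmax (λ k → countᵇ (inẼᵇ k) L)
      ≡⟨ cong (_+ sumRange i kmax (λ k → countᵇ (inẼᵇ k) L)) (countᵇ≡sumOver scaledHasPʲSolutionsᵇ L′) ⟨
    countᵇ scaledHasPʲSolutionsᵇ L′ + sumRange i kmax (λ k → countᵇ (inẼᵇ k) L) ∎
    where
    open ≡-Reasoning
    L  = allMatrices n m q
    L′ = allMatrices n m q′

  count-vanishes : j < i → countᵇ inEᵢᵇ (allMatrices n m q) ≡ 0
  count-vanishes j<i = countᵇ-false (allMatrices n m q) excluded
    where
    excluded : ∀ A → inEᵢᵇ A ≡ false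
    excluded A with firstColsDiv p i A in eq
    ... | false = ∧-zeroʳ _
    ... | true  = trans (∧-identityʳ _) (≢⇒≡ᵇ λ has → <⇒≱ (^-monoʳ-< p p>1 j<i)
                    (subst (p ^ i ≤_) has (numSolutions-≥ i A eq (≤-trans i≤m-1 (m∸n≤m m 1)))))

open import Data.Integer using (+_; _-_)

lemma3p7 : (p : ℕ) → Prime p → (s n m i j : ℕ) → 1 ≤ s → 1 ≤ n → 1 ≤ m → i ≤ m ∸ 1 →
    (Ei n m p s i j ≡ E n m p (s ∸ 1) (+ j - + m) + sumRange i (j ⊓ (m ∸ 1)) (λ k → Et n m p s k j))
    × (j < i → Ei n m p s i j ≡ 0)
lemma3p7 p p-prime (suc s) n m i j _ _ _ i≤m-1 = trans count-split (cong (_+ Ẽ-sum) E-part) , count-vanishes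
  where
  p>1 : 1 < p
  p>1 = nonTrivial⇒n>1 p {{prime⇒nonTrivial p-prime}}
  instance
    p≢0 : NonZero p
    p≢0 = >-nonZero (<-trans z<s p>1)
    p^s≢0 : NonZero (p ^ s)
    p^s≢0 = m^n≢0 p s
  open Decomposition p (p ^ s) p>1 n m i j i≤m-1
  Ẽ-sum : ℕ
  Ẽ-sum = sumRange i kmax (λ k → Et n m p (suc s) k j)
  E-part : countᵇ scaledHasPʲSolutionsᵇ (allMatrices n m (p ^ s)) ≡ E n m p s (+ j - + m)
  E-part = countᵇ-scaledSolutions n m p s j p>1
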